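{- Let $\mathfrak a_{n,m}$ be the number of $\sigma\in\mathcal{I}_n(120,201)$ with $\max(\sigma)=m$. Let $\mathfrak b_{n,k}$ be the number of words $\omega\in\mathcal W_{n,k+1}$ (words of length $n$ over $\{0,\dots,k\}$) avoiding $120$ such that $\omega_i<\omega_j\neq k$ implies $j<i$. Then for all integers $0<m<n$, $$\mathfrak a_{n,m}=\sum_{p=m+1}^{n}\sum_{j=0}^{m-1}\mathfrak a_{p-1,j}\,\mathfrak b_{n-p,m-j}.$$
   Context: For $n\in\mathbb N$, an inversion sequence of size $n$ is a sequence $\sigma=(\sigma_1,\dots,\sigma_n)\in\mathbb N^n$ with $\sigma_i<i$ for all $i$. An integer sequence contains a pattern $\rho$ (a finite integer sequence such as $120$ or $201$) if it has a subsequence order-isomorphic to $\rho$, and avoids $\rho$ otherwise. $\mathcal{I}_n(P)$ denotes the set of inversion sequences of size $n$ avoiding every pattern in the set $P$. $\mathcal W_{n,k}=\{0,\dots,k-1\}^n$ is the set of words of length $n$ over the alphabet $\{0,\dots,k-1\}$. $\max(\sigma)$ is the largest entry of $\sigma$. -}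

module Defs where

open import Data.Bool using (Bool; true; false; _∧_; not)
open import Data.Nat using (ℕ; zero; suc; _+_; _*_; _∸_; _⊔_; _≡ᵇ_; _<ᵇ_)
open import Data.List using (List; []; _∷_; _++_; [_]; map; concatMap; upTo; applyUpTo; filterᵇ; length; foldr; zip)
open import Data.Bool.ListAction using (all; any)
open import Data.Nat.ListAction using (sum)
open import Data.Product using (_,_)

-- Words / sequences are lists of naturals (index 1 = head).

data Cmp : Set where
  lt eq gt : Cmp

cmp : ℕ → ℕ → Cmp
cmp zero zero = eq
cmp zero (suc _) = lt
cmp (suc _) zero = gt
cmp (suc m) (suc n) = cmp m n

_==ᶜ_ : Cmp → Cmp → Bool
lt ==ᶜ lt = true
eq ==ᶜ eq = true
gt ==ᶜ gt = true
_ ==ᶜ _ = false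

orderIso : List ℕ → List ℕ → Bool
orderIso [] [] = true
orderIso (x ∷ xs) (y ∷ ys) =
  all (λ { (a , b) → cmp x a ==ᶜ cmp y b }) (zip xs ys) ∧ orderIso xs ys
orderIso _ _ = false

subseqs : List ℕ → List (List ℕ)
subseqs [] = [] ∷ []
subseqs (x ∷ xs) = map (x ∷_) (subseqs xs) ++ subseqs xs

contains : List ℕ → List ℕ → Bool
contains σ ρ = any (λ s → orderIso s ρ) (subseqs σ)

avoids : List ℕ → List ℕ → Bool
avoids σ ρ = not (contains σ ρ)

invSeqs : ℕ → List (List ℕ)
invSeqs zero = [] ∷ []
invSeqs (suc n) = concatMap (λ s → map (λ x → s ++ [ x ]) (upTo (suc n))) (invSeqs n)

words : ℕ → ℕ → List (List ℕ)
words zero k = [] ∷ []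
words (suc n) k = concatMap (λ x → map (x ∷_) (words n k)) (upTo k)

maxL : List ℕ → ℕ
maxL = foldr _⊔_ 0

pat120 pat201 : List ℕ
pat120 = 1 ∷ 2 ∷ 0 ∷ []
pat201 = 2 ∷ 0 ∷ 1 ∷ []

𝔞 : ℕ → ℕ → ℕ
𝔞 n m = length (filterᵇ (λ σ → avoids σ pat120 ∧ avoids σ pat201 ∧ (maxL σ ≡ᵇ m)) (invSeqs n))

-- condition: for all positions i, j,  ω_i < ω_j ≠ k  implies  j < i.
-- (equivalently: there is no pair of positions i < j with ω_i < ω_j ≠ k;
--  i = j is impossible since ω_i < ω_i fails)
condB : ℕ → List ℕ → Bool
condB k [] = true
condB k (x ∷ xs) = all (λ y → not ((x <ᵇ y) ∧ not (y ≡ᵇ k))) xs ∧ condB k xs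

𝔟 : ℕ → ℕ → ℕ
𝔟 n k = length (filterᵇ (λ ω → avoids ω pat120 ∧ condB k ω) (words n (suc k)))

-- the list [a, a+1, …, b]  (empty if b < a)
range : ℕ → ℕ → List ℕ
range a b = applyUpTo (λ i → a + i) (suc b ∸ a)

Σ[_⋯_] : ℕ → ℕ → (ℕ → ℕ) → ℕ
Σ[ a ⋯ b ] f = sum (map f (range a b))

-- Cutting σ ∈ I_n(120,201) with max σ = m > 0 at its first entry m, at position p, writes σ = s ++ m ∷ t with
-- s ∈ I_{p-1} free of m, so j = max s < m. Every entry of t lies between j and m (an entry below j would end a 120
-- started by j and m), so t = j + w for a word w over {0,…,m-j}, and the bounds σ_i < i hold on t automatically.
-- As s lies weakly below m ∷ t and both patterns end below their first entry, no occurrence straddles the cut: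
-- σ avoids 120 and 201 iff s does, w avoids 120, and w has no ascent ω_i < ω_j ≠ m-j (shifted by j, it would
-- follow m as a 201). Summing over p and j gives the formula; formally the cut is a telescoping sum over the
-- length of the m-free prefix.
module Submission where

open import Defs
open import Data.Bool using (Bool; true; false; _∧_; not; if_then_else_; T)
open import Data.Bool.ListAction using (all)
open import Data.Bool.Properties using (∧-assoc; ∧-identityʳ; ∧-zeroʳ; if-not; T-∧)
open import Data.Empty using (⊥; ⊥-elim)
open import Data.List using (List; []; _∷_; _++_; [_]; map; concatMap; upTo; filterᵇ; length)
open import Data.List.Properties using (map-++; map-∘; map-upTo; map-applyUpTo; upTo-∷ʳ; ++-assoc; ++-identityʳ)
open import Data.List.Membership.Propositional using (_∈_; find; lose)
open import Data.List.Membership.Propositional.Properties using (∈-++⁻; ∈-++⁺ˡ; ∈-++⁺ʳ; ∈-map⁺; ∈-map⁻)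
open import Data.List.Relation.Binary.Sublist.Propositional using (_⊆_; []; _∷_; _∷ʳ_; ⊆-refl; ⊆-trans; to∈; from∈)
open import Data.List.Relation.Binary.Sublist.Propositional.Properties using (++⁺; ++⁺ˡ; ++⁺ʳ; ∷ˡ⁻; map⁺; Any-resp-⊆)
open import Data.List.Relation.Unary.All using (All; []; _∷_; universal)
import Data.List.Relation.Unary.All as All
open import Data.List.Relation.Unary.All.Properties using (all-upTo; concat⁺; all⁺; all⁻; All¬⇒¬Any)
import Data.List.Relation.Unary.All.Properties as All
open import Data.List.Relation.Unary.Any using (Any; here; there)
open import Data.List.Relation.Unary.Any.Properties using (any⁺; any⁻)
open import Data.Nat using (ℕ; zero; suc; _<_; _≤_; _+_; _*_; _∸_; _≡ᵇ_; _<ᵇ_; z≤n; s≤s; z<s; s<s)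
open import Data.Nat.ListAction using (sum)
open import Data.Nat.ListAction.Properties using (sum-++)
open import Data.Nat.Properties
open import Algebra.Properties.CommutativeSemigroup +-commutativeSemigroup using (interchange)
open import Data.Product using (∃; ∃₂; ∃-syntax; _×_; _,_; proj₁; proj₂)
open import Data.Sum using (_⊎_; inj₁; inj₂)
open import Data.Unit using (tt)
open import Function using (_∘_)
open import Function.Bundles using (Equivalence)
open import Relation.Binary.Definitions using (Tri; tri<; tri≈; tri>)
open import Relation.Binary.PropositionalEquality using (_≡_; _≢_; refl; sym; trans; cong; cong₂; subst)
open import Relation.Nullary using (¬_; yes; no)

open Equivalence using (to; from)
open Relation.Binary.PropositionalEquality.≡-Reasoning

private variable
  A B : Set

𝟙 : Bool → ℕ
𝟙 b = if b then 1 else 0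

if-T : ∀ {b} {x y : A} → T b → (if b then x else y) ≡ x
if-T {b = true} _ = refl

if-¬T : ∀ {b} {x y : A} → ¬ T b → (if b then x else y) ≡ y
if-¬T {b = false} _  = refl
if-¬T {b = true}  ¬b = ⊥-elim (¬b tt)

if-then-0 : ∀ b {x} → (T b → x ≡ 0) → (if b then x else 0) ≡ 0
if-then-0 false _    = refl
if-then-0 true  x≡0 = x≡0 tt

T-not⁺ : ∀ {b} → ¬ T b → T (not b)
T-not⁺ {false} _  = tt
T-not⁺ {true}  ¬b = ¬b tt

T-not⁻ : ∀ {b} → T (not b) → ¬ T b
T-not⁻ {false} _ ()

T-injective : ∀ {a b} → (T a → T b) → (T b → T a) → a ≡ b
T-injective {false} {false} _ _ = refl
T-injective {false} {true}  _ g = ⊥-elim (g tt)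
T-injective {true}  {false} f _ = ⊥-elim (f tt)
T-injective {true}  {true}  _ _ = refl

𝟙-∧-* : ∀ b c x → 𝟙 (b ∧ c) * x ≡ (if c then 𝟙 b * x else 0)
𝟙-∧-* b true  x = cong (λ b′ → 𝟙 b′ * x) (∧-identityʳ b)
𝟙-∧-* b false x = cong (λ b′ → 𝟙 b′ * x) (∧-zeroʳ b)

∑ : List A → (A → ℕ) → ℕ
∑ xs f = sum (map f xs)

∑-++ : (xs ys : List A) (f : A → ℕ) → ∑ (xs ++ ys) f ≡ ∑ xs f + ∑ ys f
∑-++ xs ys f = trans (cong sum (map-++ f xs ys)) (sum-++ (map f xs) (map f ys))

∑-map : (xs : List B) (g : B → A) (f : A → ℕ) → ∑ (map g xs) f ≡ ∑ xs (f ∘ g)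
∑-map xs g f = cong sum (sym (map-∘ xs))

∑-concatMap : (xs : List B) (g : B → List A) (f : A → ℕ) →
  ∑ (concatMap g xs) f ≡ ∑ xs (λ x → ∑ (g x) f)
∑-concatMap []       g f = refl
∑-concatMap (x ∷ xs) g f = trans (∑-++ (g x) _ f) (cong (∑ (g x) f +_) (∑-concatMap xs g f))

∑-cong-All : {xs : List A} {f g : A → ℕ} → All (λ x → f x ≡ g x) xs → ∑ xs f ≡ ∑ xs g
∑-cong-All []       = refl
∑-cong-All (e ∷ es) = cong₂ _+_ e (∑-cong-All es)

∑-cong : (xs : List A) {f g : A → ℕ} → (∀ x → f x ≡ g x) → ∑ xs f ≡ ∑ xs g
∑-cong xs e = ∑-cong-All (universal e xs)

∑-concatMap-map : ∀ {C : Set} (xs : List A) (ys : A → List B) (g : A → B → C) (F : C → ℕ) →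
  ∑ (concatMap (λ x → map (g x) (ys x)) xs) F ≡ ∑ xs (λ x → ∑ (ys x) (λ y → F (g x y)))
∑-concatMap-map xs ys g F = trans (∑-concatMap xs _ F) (∑-cong xs (λ x → ∑-map (ys x) (g x) F))

∑-zero-All : {xs : List A} {f : A → ℕ} → All (λ x → f x ≡ 0) xs → ∑ xs f ≡ 0
∑-zero-All []       = refl
∑-zero-All (e ∷ es) = cong₂ _+_ e (∑-zero-All es)

∑-zero : (xs : List A) {f : A → ℕ} → (∀ x → f x ≡ 0) → ∑ xs f ≡ 0
∑-zero xs e = ∑-zero-All (universal e xs)

∑-+ : (xs : List A) (f g : A → ℕ) → ∑ xs (λ x → f x + g x) ≡ ∑ xs f + ∑ xs g
∑-+ []       f g = refl
∑-+ (x ∷ xs) f g = trans (cong (f x + g x +_) (∑-+ xs f g)) (interchange (f x) (g x) (∑ xs f) (∑ xs g))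

∑-*ʳ : (xs : List A) (f : A → ℕ) (c : ℕ) → ∑ xs (λ x → f x * c) ≡ ∑ xs f * c
∑-*ʳ []       f c = refl
∑-*ʳ (x ∷ xs) f c = trans (cong (f x * c +_) (∑-*ʳ xs f c)) (sym (*-distribʳ-+ c (f x) (∑ xs f)))

∑-comm : (xs : List A) (ys : List B) (f : A → B → ℕ) →
  ∑ xs (λ x → ∑ ys (f x)) ≡ ∑ ys (λ y → ∑ xs (λ x → f x y))
∑-comm []       ys f = sym (∑-zero ys (λ _ → refl))
∑-comm (x ∷ xs) ys f = trans (cong (∑ ys (f x) +_) (∑-comm xs ys f)) (sym (∑-+ ys (f x) _))

length-filterᵇ : (p : A → Bool) (xs : List A) → length (filterᵇ p xs) ≡ ∑ xs (𝟙 ∘ p)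
length-filterᵇ p []       = refl
length-filterᵇ p (x ∷ xs) with p x
... | true  = cong suc (length-filterᵇ p xs)
... | false = length-filterᵇ p xs

∑-𝟙-∧ : ∀ b (p : A → Bool) xs → ∑ xs (λ x → 𝟙 (b ∧ p x)) ≡ 𝟙 b * length (filterᵇ p xs)
∑-𝟙-∧ true  p xs = trans (sym (length-filterᵇ p xs)) (sym (+-identityʳ _))
∑-𝟙-∧ false p xs = ∑-zero xs (λ _ → refl)

∑-upTo-suc : ∀ k (f : ℕ → ℕ) → ∑ (upTo (suc k)) f ≡ ∑ (upTo k) f + f k
∑-upTo-suc k f = begin
  ∑ (upTo (suc k)) f       ≡⟨ cong (λ xs → ∑ xs f) (upTo-∷ʳ k) ⟨
  ∑ (upTo k ++ [ k ]) f    ≡⟨ ∑-++ (upTo k) [ k ] f ⟩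
  ∑ (upTo k) f + (f k + 0) ≡⟨ cong (∑ (upTo k) f +_) (+-identityʳ (f k)) ⟩
  ∑ (upTo k) f + f k       ∎

∑-upTo-+ : ∀ j b (f : ℕ → ℕ) → ∑ (upTo (j + b)) f ≡ ∑ (upTo j) f + ∑ (upTo b) (λ y → f (j + y))
∑-upTo-+ j zero    f = trans (cong (λ z → ∑ (upTo z) f) (+-identityʳ j)) (sym (+-identityʳ _))
∑-upTo-+ j (suc b) f = begin
  ∑ (upTo (j + suc b)) f                                       ≡⟨ cong (λ z → ∑ (upTo z) f) (+-suc j b) ⟩
  ∑ (upTo (suc (j + b))) f                                     ≡⟨ ∑-upTo-suc (j + b) f ⟩
  ∑ (upTo (j + b)) f + f (j + b)                               ≡⟨ cong (_+ f (j + b)) (∑-upTo-+ j b f) ⟩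
  ∑ (upTo j) f + ∑ (upTo b) (λ y → f (j + y)) + f (j + b)      ≡⟨ +-assoc (∑ (upTo j) f) _ _ ⟩
  ∑ (upTo j) f + (∑ (upTo b) (λ y → f (j + y)) + f (j + b))    ≡⟨ cong (∑ (upTo j) f +_) (∑-upTo-suc b (λ y → f (j + y))) ⟨
  ∑ (upTo j) f + ∑ (upTo (suc b)) (λ y → f (j + y))            ∎

∑-upTo-vanishingˡ : ∀ j b (f : ℕ → ℕ) → (∀ x → x < j → f x ≡ 0) →
  ∑ (upTo (j + b)) f ≡ ∑ (upTo b) (λ y → f (j + y))
∑-upTo-vanishingˡ j b f vanish = begin
  ∑ (upTo (j + b)) f
    ≡⟨ ∑-upTo-+ j b f ⟩
  ∑ (upTo j) f + ∑ (upTo b) (λ y → f (j + y))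
    ≡⟨ cong (_+ ∑ (upTo b) (λ y → f (j + y))) (∑-zero-All (All.map (λ {x} → vanish x) (all-upTo j))) ⟩
  ∑ (upTo b) (λ y → f (j + y)) ∎

∑-upTo-vanishingʳ : ∀ {a b} (f : ℕ → ℕ) → b ≤ a → (∀ x → b ≤ x → f x ≡ 0) → ∑ (upTo a) f ≡ ∑ (upTo b) f
∑-upTo-vanishingʳ {a} {b} f b≤a vanish = begin
  ∑ (upTo a) f
    ≡⟨ cong (λ z → ∑ (upTo z) f) (m+[n∸m]≡n b≤a) ⟨
  ∑ (upTo (b + (a ∸ b))) f
    ≡⟨ ∑-upTo-+ b (a ∸ b) f ⟩
  ∑ (upTo b) f + ∑ (upTo (a ∸ b)) (λ y → f (b + y))
    ≡⟨ cong (∑ (upTo b) f +_) (∑-zero (upTo (a ∸ b)) (λ y → vanish (b + y) (m≤m+n b y))) ⟩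
  ∑ (upTo b) f + 0
    ≡⟨ +-identityʳ _ ⟩
  ∑ (upTo b) f ∎

∑-upTo-select : ∀ k v (f : ℕ → ℕ) → ∑ (upTo k) (λ x → if v ≡ᵇ x then f x else 0) ≡ (if v <ᵇ k then f v else 0)
∑-upTo-select zero    v f = refl
∑-upTo-select (suc k) v f = begin
  ∑ (upTo (suc k)) g                              ≡⟨ ∑-upTo-suc k g ⟩
  ∑ (upTo k) g + g k                              ≡⟨ cong (_+ g k) (∑-upTo-select k v f) ⟩
  (if v <ᵇ k then f v else 0) + g k               ≡⟨ addLast (<-cmp v k) ⟩
  (if v <ᵇ suc k then f v else 0)                 ∎
  where
  g : ℕ → ℕ
  g x = if v ≡ᵇ x then f x else 0
  addLast : Tri (v < k) (v ≡ k) (k < v) → (if v <ᵇ k then f v else 0) + g k ≡ (if v <ᵇ suc k then f v else 0)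
  addLast (tri< v<k v≢k _) = begin
    (if v <ᵇ k then f v else 0) + g k ≡⟨ cong₂ _+_ (if-T (<⇒<ᵇ v<k)) (if-¬T (v≢k ∘ ≡ᵇ⇒≡ v k)) ⟩
    f v + 0                           ≡⟨ +-identityʳ (f v) ⟩
    f v                               ≡⟨ if-T (<⇒<ᵇ (m<n⇒m<1+n v<k)) ⟨
    (if v <ᵇ suc k then f v else 0)   ∎
  addLast (tri≈ v≮k refl _) = begin
    (if v <ᵇ v then f v else 0) + g v ≡⟨ cong₂ _+_ (if-¬T (v≮k ∘ <ᵇ⇒< v v)) (if-T (≡⇒≡ᵇ v v refl)) ⟩
    f v                               ≡⟨ if-T (<⇒<ᵇ (n<1+n v)) ⟨
    (if v <ᵇ suc v then f v else 0)   ∎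
  addLast (tri> v≮k v≢k k<v) = begin
    (if v <ᵇ k then f v else 0) + g k ≡⟨ cong₂ _+_ (if-¬T (v≮k ∘ <ᵇ⇒< v k)) (if-¬T (v≢k ∘ ≡ᵇ⇒≡ v k)) ⟩
    0                                 ≡⟨ if-¬T (<⇒≱ k<v ∘ ≤-pred ∘ <ᵇ⇒< v (suc k)) ⟨
    (if v <ᵇ suc k then f v else 0)   ∎

∑-upTo-split : ∀ m k (f : ℕ → ℕ) →
  ∑ (upTo k) f ≡ (if m <ᵇ k then f m else 0) + ∑ (upTo k) (λ x → if m ≡ᵇ x then 0 else f x)
∑-upTo-split m k f = begin
  ∑ (upTo k) f
    ≡⟨ ∑-cong (upTo k) pointwise ⟩
  ∑ (upTo k) (λ x → (if m ≡ᵇ x then f x else 0) + (if m ≡ᵇ x then 0 else f x))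
    ≡⟨ ∑-+ (upTo k) _ _ ⟩
  ∑ (upTo k) (λ x → if m ≡ᵇ x then f x else 0) + ∑ (upTo k) (λ x → if m ≡ᵇ x then 0 else f x)
    ≡⟨ cong (_+ ∑ (upTo k) (λ x → if m ≡ᵇ x then 0 else f x)) (∑-upTo-select k m f) ⟩
  (if m <ᵇ k then f m else 0) + ∑ (upTo k) (λ x → if m ≡ᵇ x then 0 else f x) ∎
  where
  pointwise : ∀ x → f x ≡ (if m ≡ᵇ x then f x else 0) + (if m ≡ᵇ x then 0 else f x)
  pointwise x with m ≡ᵇ x
  ... | true  = sym (+-identityʳ (f x))
  ... | false = refl

telescope : ∀ (F R : ℕ → ℕ) N → (∀ q → q < N → F q ≡ R q + F (suc q)) → F 0 ≡ ∑ (upTo N) R + F N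
telescope F R zero    step = refl
telescope F R (suc N) step = begin
  F 0                                 ≡⟨ telescope F R N (λ q q<N → step q (m<n⇒m<1+n q<N)) ⟩
  ∑ (upTo N) R + F N                  ≡⟨ cong (∑ (upTo N) R +_) (step N (n<1+n N)) ⟩
  ∑ (upTo N) R + (R N + F (suc N))    ≡⟨ +-assoc (∑ (upTo N) R) (R N) _ ⟨
  ∑ (upTo N) R + R N + F (suc N)      ≡⟨ cong (_+ F (suc N)) (∑-upTo-suc N R) ⟨
  ∑ (upTo (suc N)) R + F (suc N)      ∎

Σ[suc-⋯]≡∑ : ∀ a n (F : ℕ → ℕ) → Σ[ suc a ⋯ n ] F ≡ ∑ (upTo (n ∸ a)) (λ i → F (suc a + i))
Σ[suc-⋯]≡∑ a n F = cong sum (trans (map-applyUpTo (suc a +_) F (n ∸ a)) (sym (map-upTo (λ i → F (suc a + i)) (n ∸ a))))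

-- The lists u of length k with s ++ u ∈ I_{p+k} whenever s ∈ I_p.
invSuffixes : ℕ → ℕ → List (List ℕ)
invSuffixes p zero    = [] ∷ []
invSuffixes p (suc k) = concatMap (λ x → map (x ∷_) (invSuffixes (suc p) k)) (upTo (suc p))

∑-invSuffixes-suc : ∀ p k (F : List ℕ → ℕ) →
  ∑ (invSuffixes p (suc k)) F ≡ ∑ (upTo (suc p)) (λ x → ∑ (invSuffixes (suc p) k) (λ u → F (x ∷ u)))
∑-invSuffixes-suc p k F = ∑-concatMap-map (upTo (suc p)) (λ _ → invSuffixes (suc p) k) _∷_ F

∑-words-suc : ∀ k K (F : List ℕ → ℕ) →
  ∑ (words (suc k) K) F ≡ ∑ (upTo K) (λ x → ∑ (words k K) (λ w → F (x ∷ w)))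
∑-words-suc k K F = ∑-concatMap-map (upTo K) (λ _ → words k K) _∷_ F

∑-invSeqs-suc : ∀ p (F : List ℕ → ℕ) →
  ∑ (invSeqs (suc p)) F ≡ ∑ (invSeqs p) (λ s → ∑ (upTo (suc p)) (λ x → F (s ++ [ x ])))
∑-invSeqs-suc p F = ∑-concatMap-map (invSeqs p) (λ _ → upTo (suc p)) (λ s x → s ++ [ x ]) F

∑-invSeqs-+ : ∀ p k (F : List ℕ → ℕ) →
  ∑ (invSeqs (p + k)) F ≡ ∑ (invSeqs p) (λ s → ∑ (invSuffixes p k) (λ u → F (s ++ u)))
∑-invSeqs-+ p zero    F = begin
  ∑ (invSeqs (p + 0)) F                 ≡⟨ cong (λ z → ∑ (invSeqs z) F) (+-identityʳ p) ⟩
  ∑ (invSeqs p) F                       ≡⟨ ∑-cong (invSeqs p) (λ s → trans (+-identityʳ _) (cong F (++-identityʳ s))) ⟨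
  ∑ (invSeqs p) (λ s → F (s ++ []) + 0) ∎
∑-invSeqs-+ p (suc k) F = begin
  ∑ (invSeqs (p + suc k)) F
    ≡⟨ cong (λ z → ∑ (invSeqs z) F) (+-suc p k) ⟩
  ∑ (invSeqs (suc p + k)) F
    ≡⟨ ∑-invSeqs-+ (suc p) k F ⟩
  ∑ (invSeqs (suc p)) (λ s → ∑ (invSuffixes (suc p) k) (λ u → F (s ++ u)))
    ≡⟨ ∑-invSeqs-suc p _ ⟩
  ∑ (invSeqs p) (λ s → ∑ (upTo (suc p)) (λ x → ∑ (invSuffixes (suc p) k) (λ u → F ((s ++ [ x ]) ++ u))))
    ≡⟨ ∑-cong (invSeqs p) (λ s → ∑-cong (upTo (suc p)) (λ x →
         ∑-cong (invSuffixes (suc p) k) (λ u → cong F (++-assoc s [ x ] u)))) ⟩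
  ∑ (invSeqs p) (λ s → ∑ (upTo (suc p)) (λ x → ∑ (invSuffixes (suc p) k) (λ u → F (s ++ x ∷ u))))
    ≡⟨ ∑-cong (invSeqs p) (λ s → ∑-invSuffixes-suc p k (λ u → F (s ++ u))) ⟨
  ∑ (invSeqs p) (λ s → ∑ (invSuffixes p (suc k)) (λ u → F (s ++ u))) ∎

words-bounded : ∀ k K → All (All (_< K)) (words k K)
words-bounded zero    K = [] ∷ []
words-bounded (suc k) K =
  concat⁺ (All.map⁺ (All.map (λ x<K → All.map⁺ (All.map (x<K ∷_) (words-bounded k K))) (all-upTo K)))

-- Once H ignores entries above m, the growing bounds of an inversion-sequence tail starting beyond m are irrelevant.
∑-invSuffixes-bounded : ∀ k {p m} (H : List ℕ → ℕ) → m < p → (∀ t → Any (m <_) t → H t ≡ 0) →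
  ∑ (invSuffixes p k) H ≡ ∑ (words k (suc m)) H
∑-invSuffixes-bounded zero    H m<p vanish = refl
∑-invSuffixes-bounded (suc k) {p} {m} H m<p vanish = begin
  ∑ (invSuffixes p (suc k)) H
    ≡⟨ ∑-invSuffixes-suc p k H ⟩
  ∑ (upTo (suc p)) (λ x → ∑ (invSuffixes (suc p) k) (λ u → H (x ∷ u)))
    ≡⟨ ∑-cong (upTo (suc p)) (λ x →
         ∑-invSuffixes-bounded k (λ u → H (x ∷ u)) (m<n⇒m<1+n m<p) (λ u → vanish (x ∷ u) ∘ there)) ⟩
  ∑ (upTo (suc p)) (λ x → ∑ (words k (suc m)) (λ w → H (x ∷ w)))
    ≡⟨ ∑-upTo-vanishingʳ _ (m≤n⇒m≤1+n m<p) (λ x m<x → ∑-zero (words k (suc m)) (λ w → vanish (x ∷ w) (here m<x))) ⟩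
  ∑ (upTo (suc m)) (λ x → ∑ (words k (suc m)) (λ w → H (x ∷ w)))
    ≡⟨ ∑-words-suc k (suc m) H ⟨
  ∑ (words (suc k) (suc m)) H ∎

∑-words-shift : ∀ k j K (H : List ℕ → ℕ) → (∀ w → Any (_< j) w → H w ≡ 0) →
  ∑ (words k (j + K)) H ≡ ∑ (words k K) (H ∘ map (j +_))
∑-words-shift zero    j K H vanish = refl
∑-words-shift (suc k) j K H vanish = begin
  ∑ (words (suc k) (j + K)) H
    ≡⟨ ∑-words-suc k (j + K) H ⟩
  ∑ (upTo (j + K)) (λ x → ∑ (words k (j + K)) (λ w → H (x ∷ w)))
    ≡⟨ ∑-cong (upTo (j + K)) (λ x → ∑-words-shift k j K (λ w → H (x ∷ w)) (λ w → vanish (x ∷ w) ∘ there)) ⟩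
  ∑ (upTo (j + K)) (λ x → ∑ (words k K) (λ w → H (x ∷ map (j +_) w)))
    ≡⟨ ∑-upTo-vanishingˡ j K _ (λ x x<j → ∑-zero (words k K) (λ w → vanish (x ∷ map (j +_) w) (here x<j))) ⟩
  ∑ (upTo K) (λ y → ∑ (words k K) (λ w → H (j + y ∷ map (j +_) w)))
    ≡⟨ ∑-words-suc k K (H ∘ map (j +_)) ⟨
  ∑ (words (suc k) K) (H ∘ map (j +_)) ∎

maxL-upper : ∀ xs → All (_≤ maxL xs) xs
maxL-upper []       = []
maxL-upper (x ∷ xs) = m≤m⊔n x (maxL xs) ∷ All.map (λ y≤ → ≤-trans y≤ (m≤n⊔m x (maxL xs))) (maxL-upper xs)

maxL-least : ∀ {M} xs → All (_≤ M) xs → maxL xs ≤ M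
maxL-least []       []         = z≤n
maxL-least (x ∷ xs) (x≤ ∷ xs≤) = ⊔-lub x≤ (maxL-least xs xs≤)

maxL-∈ : ∀ xs → 0 < maxL xs → maxL xs ∈ xs
maxL-∈ (x ∷ xs) pos with ⊔-sel x (maxL xs)
... | inj₁ max≡x  = here max≡x
... | inj₂ max≡xs = there (subst (_∈ xs) (sym max≡xs) (maxL-∈ xs (subst (0 <_) max≡xs pos)))

lacks : ℕ → List ℕ → Bool
lacks m = all (λ y → not (m ≡ᵇ y))

lacks-∷ʳ : ∀ m s x → lacks m (s ++ [ x ]) ≡ lacks m s ∧ not (m ≡ᵇ x)
lacks-∷ʳ m []      x = ∧-identityʳ _
lacks-∷ʳ m (y ∷ s) x = trans (cong (not (m ≡ᵇ y) ∧_) (lacks-∷ʳ m s x)) (sym (∧-assoc (not (m ≡ᵇ y)) _ _))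

lacks⇒∉ : ∀ {m} s → T (lacks m s) → m ∈ s → ⊥
lacks⇒∉ {m} s h m∈s = T-not⁻ (All.lookup (all⁺ _ s h) m∈s) (≡⇒≡ᵇ m m refl)

maxL<⇒lacks : ∀ {m} s → maxL s < m → T (lacks m s)
maxL<⇒lacks {m} s maxL<m =
  all⁻ _ (All.map (λ {y} y≤max → T-not⁺ (λ m≡y → <⇒≱ maxL<m (subst (_≤ maxL s) (sym (≡ᵇ⇒≡ m y m≡y)) y≤max)))
                  (maxL-upper s))

-- firstAt q sums I over the sequences whose first entry m sits at position q + 1, withoutM q over those with no m
-- among their first q entries.
module FirstOccurrence (N m : ℕ) (I : List ℕ → ℕ) where

  completions : ℕ → List ℕ → ℕ
  completions q s = ∑ (invSuffixes q (N ∸ q)) (λ u → I (s ++ u))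

  withoutM : ℕ → ℕ
  withoutM q = ∑ (invSeqs q) (λ s → if lacks m s then completions q s else 0)

  firstAt : ℕ → ℕ
  firstAt q = ∑ (invSeqs q) (λ s → if lacks m s then (if m <ᵇ suc q then completions (suc q) (s ++ [ m ]) else 0) else 0)

  completions-suc : ∀ q s → q < N → completions q s ≡ ∑ (upTo (suc q)) (λ x → completions (suc q) (s ++ [ x ]))
  completions-suc q s q<N = begin
    completions q s
      ≡⟨ cong (λ k → ∑ (invSuffixes q k) (λ u → I (s ++ u))) (+-∸-assoc 1 q<N) ⟩
    ∑ (invSuffixes q (suc (N ∸ suc q))) (λ u → I (s ++ u))
      ≡⟨ ∑-invSuffixes-suc q (N ∸ suc q) (λ u → I (s ++ u)) ⟩
    ∑ (upTo (suc q)) (λ x → ∑ (invSuffixes (suc q) (N ∸ suc q)) (λ u → I (s ++ x ∷ u)))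
      ≡⟨ ∑-cong (upTo (suc q)) (λ x → ∑-cong (invSuffixes (suc q) (N ∸ suc q)) (λ u → cong I (++-assoc s [ x ] u))) ⟨
    ∑ (upTo (suc q)) (λ x → completions (suc q) (s ++ [ x ])) ∎

  split-prefix : ∀ q s → q < N →
    (if lacks m s then completions q s else 0) ≡
    (if lacks m s then (if m <ᵇ suc q then completions (suc q) (s ++ [ m ]) else 0) else 0)
    + ∑ (upTo (suc q)) (λ x → if lacks m (s ++ [ x ]) then completions (suc q) (s ++ [ x ]) else 0)
  split-prefix q s q<N with lacks m s in lacks-s
  ... | false = sym (∑-zero (upTo (suc q)) λ x →
    cong (λ b → if b then completions (suc q) (s ++ [ x ]) else 0) (trans (lacks-∷ʳ m s x) (cong (_∧ _) lacks-s)))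
  ... | true  = begin
    completions q s
      ≡⟨ completions-suc q s q<N ⟩
    ∑ (upTo (suc q)) extend
      ≡⟨ ∑-upTo-split m (suc q) extend ⟩
    (if m <ᵇ suc q then extend m else 0) + ∑ (upTo (suc q)) (λ x → if m ≡ᵇ x then 0 else extend x)
      ≡⟨ cong ((if m <ᵇ suc q then extend m else 0) +_) (∑-cong (upTo (suc q)) λ x →
           trans (sym (if-not (m ≡ᵇ x))) (cong (λ b → if b then extend x else 0) (sym (lacks-after x)))) ⟩
    (if m <ᵇ suc q then extend m else 0) + ∑ (upTo (suc q)) (λ x → if lacks m (s ++ [ x ]) then extend x else 0) ∎
    where
    extend : ℕ → ℕ
    extend x = completions (suc q) (s ++ [ x ])
    lacks-after : ∀ x → lacks m (s ++ [ x ]) ≡ not (m ≡ᵇ x)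
    lacks-after x = trans (lacks-∷ʳ m s x) (cong (_∧ _) lacks-s)

  withoutM-suc : ∀ q → q < N → withoutM q ≡ firstAt q + withoutM (suc q)
  withoutM-suc q q<N = begin
    withoutM q
      ≡⟨ ∑-cong (invSeqs q) (λ s → split-prefix q s q<N) ⟩
    ∑ (invSeqs q) (λ s → placeM s + placeOther s)
      ≡⟨ ∑-+ (invSeqs q) placeM placeOther ⟩
    firstAt q + ∑ (invSeqs q) placeOther
      ≡⟨ cong (firstAt q +_) (∑-invSeqs-suc q (λ s → if lacks m s then completions (suc q) s else 0)) ⟨
    firstAt q + withoutM (suc q) ∎
    where
    placeM placeOther : List ℕ → ℕ
    placeM s = if lacks m s then (if m <ᵇ suc q then completions (suc q) (s ++ [ m ]) else 0) else 0
    placeOther s = ∑ (upTo (suc q)) (λ x → if lacks m (s ++ [ x ]) then completions (suc q) (s ++ [ x ]) else 0)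

  firstAt-< : ∀ q → q < m → firstAt q ≡ 0
  firstAt-< q q<m =
    ∑-zero (invSeqs q) (λ s → if-then-0 (lacks m s) (λ _ → if-¬T (<⇒≱ q<m ∘ ≤-pred ∘ <ᵇ⇒< m (suc q))))

  firstOccurrence : ∑ (invSeqs N) I ≡ ∑ (upTo N) firstAt + ∑ (invSeqs N) (λ s → if lacks m s then I s else 0)
  firstOccurrence = begin
    ∑ (invSeqs N) I                 ≡⟨ ∑-invSeqs-+ 0 N I ⟩
    withoutM 0                      ≡⟨ telescope withoutM firstAt N withoutM-suc ⟩
    ∑ (upTo N) firstAt + withoutM N ≡⟨ cong (∑ (upTo N) firstAt +_) (∑-cong (invSeqs N) complete) ⟩
    ∑ (upTo N) firstAt + ∑ (invSeqs N) (λ s → if lacks m s then I s else 0) ∎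
    where
    complete : ∀ s → (if lacks m s then completions N s else 0) ≡ (if lacks m s then I s else 0)
    complete s rewrite n∸n≡0 N =
      cong (λ x → if lacks m s then x else 0) (trans (+-identityʳ _) (cong I (++-identityʳ s)))

⊆⇒∈-subseqs : ∀ {xs ys} → xs ⊆ ys → xs ∈ subseqs ys
⊆⇒∈-subseqs []         = here refl
⊆⇒∈-subseqs (y ∷ʳ p)   = ∈-++⁺ʳ _ (⊆⇒∈-subseqs p)
⊆⇒∈-subseqs (refl ∷ p) = ∈-++⁺ˡ (∈-map⁺ (_ ∷_) (⊆⇒∈-subseqs p))

∈-subseqs⇒⊆ : ∀ {xs} ys → xs ∈ subseqs ys → xs ⊆ ys
∈-subseqs⇒⊆ []       (here refl) = []
∈-subseqs⇒⊆ (y ∷ ys) p with ∈-++⁻ (map (y ∷_) (subseqs ys)) p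
... | inj₂ q = y ∷ʳ ∈-subseqs⇒⊆ ys q
... | inj₁ q with ∈-map⁻ (y ∷_) q
...   | zs , zs∈ , refl = refl ∷ ∈-subseqs⇒⊆ ys zs∈

⊆-++⁻ : ∀ l {r xs : List A} → xs ⊆ l ++ r → ∃₂ λ xs₁ xs₂ → xs ≡ xs₁ ++ xs₂ × xs₁ ⊆ l × xs₂ ⊆ r
⊆-++⁻ []      p = [] , _ , refl , [] , p
⊆-++⁻ (y ∷ l) (.y ∷ʳ p) with ⊆-++⁻ l p
... | xs₁ , xs₂ , refl , p₁ , p₂ = xs₁ , xs₂ , refl , y ∷ʳ p₁ , p₂
⊆-++⁻ (y ∷ l) (refl ∷ p) with ⊆-++⁻ l p
... | xs₁ , xs₂ , refl , p₁ , p₂ = y ∷ xs₁ , xs₂ , refl , refl ∷ p₁ , p₂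

⊆-map⁻ : ∀ (f : A → B) {xs} ys → xs ⊆ map f ys → ∃ λ zs → zs ⊆ ys × xs ≡ map f zs
⊆-map⁻ f []       []         = [] , [] , refl
⊆-map⁻ f (y ∷ ys) (_ ∷ʳ p)   with ⊆-map⁻ f ys p
... | zs , q , refl = zs , y ∷ʳ q , refl
⊆-map⁻ f (y ∷ ys) (refl ∷ p) with ⊆-map⁻ f ys p
... | zs , q , refl = y ∷ zs , refl ∷ q , refl

contains⇒sublist : ∀ σ ρ → T (contains σ ρ) → ∃ λ xs → xs ⊆ σ × T (orderIso xs ρ)
contains⇒sublist σ ρ h with find (any⁻ (λ xs → orderIso xs ρ) (subseqs σ) h)
... | xs , xs∈ , iso = xs , ∈-subseqs⇒⊆ σ xs∈ , iso

sublist⇒contains : ∀ {xs σ} ρ → xs ⊆ σ → T (orderIso xs ρ) → T (contains σ ρ)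
sublist⇒contains ρ p iso = any⁺ (λ xs → orderIso xs ρ) (lose (⊆⇒∈-subseqs p) iso)

orderIso-length : ∀ xs ys → T (orderIso xs ys) → length xs ≡ length ys
orderIso-length []       []       _   = refl
orderIso-length (x ∷ xs) (y ∷ ys) iso = cong suc (orderIso-length xs ys (proj₂ (to T-∧ iso)))

cmp-< : ∀ {a b} → a < b → cmp a b ≡ lt
cmp-< {zero}  {suc b} _         = refl
cmp-< {suc a} {suc b} (s<s a<b) = cmp-< a<b

cmp-> : ∀ {a b} → b < a → cmp a b ≡ gt
cmp-> {suc a} {zero}  _         = refl
cmp-> {suc a} {suc b} (s<s b<a) = cmp-> b<a

cmp≡lt⇒< : ∀ a b → cmp a b ≡ lt → a < b
cmp≡lt⇒< zero    (suc b) _ = z<s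
cmp≡lt⇒< (suc a) (suc b) h = s<s (cmp≡lt⇒< a b h)

cmp≡gt⇒> : ∀ a b → cmp a b ≡ gt → b < a
cmp≡gt⇒> (suc a) zero    _ = z<s
cmp≡gt⇒> (suc a) (suc b) h = s<s (cmp≡gt⇒> a b h)

Occurs : (ℕ → ℕ → ℕ → Set) → List ℕ → Set
Occurs R σ = ∃[ a ] ∃[ b ] ∃[ c ] (a ∷ b ∷ c ∷ []) ⊆ σ × R a b c

Is120 Is201 : ℕ → ℕ → ℕ → Set
Is120 a b c = c < a × a < b
Is201 a b c = b < c × c < a

orderIso-120⁺ : ∀ {a b c} → Is120 a b c → T (orderIso (a ∷ b ∷ c ∷ []) pat120)
orderIso-120⁺ (c<a , a<b) rewrite cmp-< a<b | cmp-> c<a | cmp-> (<-trans c<a a<b) = tt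

orderIso-120⁻ : ∀ a b c → T (orderIso (a ∷ b ∷ c ∷ []) pat120) → Is120 a b c
orderIso-120⁻ a b c iso with cmp a b in ab | cmp a c in ac
... | lt | gt = cmp≡gt⇒> a c ac , cmp≡lt⇒< a b ab
orderIso-120⁻ a b c () | lt | lt
orderIso-120⁻ a b c () | lt | eq
orderIso-120⁻ a b c () | eq | _
orderIso-120⁻ a b c () | gt | _

orderIso-201⁺ : ∀ {a b c} → Is201 a b c → T (orderIso (a ∷ b ∷ c ∷ []) pat201)
orderIso-201⁺ (b<c , c<a) rewrite cmp-> (<-trans b<c c<a) | cmp-> c<a | cmp-< b<c = tt

orderIso-201⁻ : ∀ a b c → T (orderIso (a ∷ b ∷ c ∷ []) pat201) → Is201 a b c
orderIso-201⁻ a b c iso with cmp a b | cmp a c in ac | cmp b c in bc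
... | gt | gt | lt = cmp≡lt⇒< b c bc , cmp≡gt⇒> a c ac
orderIso-201⁻ a b c () | lt | _  | _
orderIso-201⁻ a b c () | eq | _  | _
orderIso-201⁻ a b c () | gt | lt | _
orderIso-201⁻ a b c () | gt | eq | _
orderIso-201⁻ a b c () | gt | gt | eq
orderIso-201⁻ a b c () | gt | gt | gt

module Pattern (ρ : List ℕ) (R : ℕ → ℕ → ℕ → Set) (length-ρ : length ρ ≡ 3)
  (iso⁺ : ∀ {a b c} → R a b c → T (orderIso (a ∷ b ∷ c ∷ []) ρ))
  (iso⁻ : ∀ a b c → T (orderIso (a ∷ b ∷ c ∷ []) ρ) → R a b c) where

  contains⇒Occurs : ∀ σ → T (contains σ ρ) → Occurs R σ
  contains⇒Occurs σ h with contains⇒sublist σ ρ h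
  ... | xs , p , iso = triple xs (trans (orderIso-length xs ρ iso) length-ρ) p iso
    where
    triple : ∀ xs → length xs ≡ 3 → xs ⊆ σ → T (orderIso xs ρ) → Occurs R σ
    triple (a ∷ b ∷ c ∷ []) refl p iso = a , b , c , p , iso⁻ a b c iso
    triple []                        () _ _
    triple (_ ∷ [])                  () _ _
    triple (_ ∷ _ ∷ [])              () _ _
    triple (_ ∷ _ ∷ _ ∷ _ ∷ _)       () _ _

  avoids⇒¬Occurs : ∀ {σ} → T (avoids σ ρ) → ¬ Occurs R σ
  avoids⇒¬Occurs h (a , b , c , p , r) = T-not⁻ h (sublist⇒contains ρ p (iso⁺ r))

  ¬Occurs⇒avoids : ∀ {σ} → ¬ Occurs R σ → T (avoids σ ρ)
  ¬Occurs⇒avoids {σ} ¬occ = T-not⁺ (¬occ ∘ contains⇒Occurs σ)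

module P120 = Pattern pat120 Is120 refl orderIso-120⁺ orderIso-120⁻
module P201 = Pattern pat201 Is201 refl orderIso-201⁺ orderIso-201⁻

Occurs-⊆ : ∀ {R xs ys} → xs ⊆ ys → Occurs R xs → Occurs R ys
Occurs-⊆ q (a , b , c , p , r) = a , b , c , ⊆-trans p q , r

Occurs-map⁺ : ∀ {R} (f : ℕ → ℕ) → (∀ {a b c} → R a b c → R (f a) (f b) (f c)) → ∀ {w} → Occurs R w → Occurs R (map f w)
Occurs-map⁺ f mono (a , b , c , p , r) = f a , f b , f c , map⁺ f p , mono r

Occurs-map⁻ : ∀ {R} (f : ℕ → ℕ) → (∀ {a b c} → R (f a) (f b) (f c) → R a b c) → ∀ w → Occurs R (map f w) → Occurs R w
Occurs-map⁻ f reflect w (a , b , c , p , r) with ⊆-map⁻ f w p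
... | a' ∷ b' ∷ c' ∷ [] , q , refl = a' , b' , c' , q , reflect r
... | []                , _ , ()
... | _ ∷ []            , _ , ()
... | _ ∷ _ ∷ []        , _ , ()
... | _ ∷ _ ∷ _ ∷ _ ∷ _ , _ , ()

Occurs-++ : ∀ {R} → (∀ {a b c} → R a b c → c < a) → ∀ l {r} → All (λ x → All (x ≤_) r) l →
  Occurs R (l ++ r) → Occurs R l ⊎ Occurs R r
Occurs-++ c<a l l≤r (a , b , c , p , Rabc) with ⊆-++⁻ l p
... | [] , _ , refl , _ , p₂ = inj₂ (a , b , c , p₂ , Rabc)
... | _ ∷ [] , _ , refl , p₁ , p₂ =
  ⊥-elim (<⇒≱ (c<a Rabc) (All.lookup (All.lookup l≤r (Any-resp-⊆ p₁ (here refl))) (Any-resp-⊆ p₂ (there (here refl)))))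
... | _ ∷ _ ∷ [] , _ , refl , p₁ , p₂ =
  ⊥-elim (<⇒≱ (c<a Rabc) (All.lookup (All.lookup l≤r (Any-resp-⊆ p₁ (here refl))) (Any-resp-⊆ p₂ (here refl))))
... | _ ∷ _ ∷ _ ∷ [] , _ , refl , p₁ , _ = inj₁ (a , b , c , p₁ , Rabc)
... | _ ∷ _ ∷ _ ∷ _ ∷ _ , _ , () , _

condB⇒ : ∀ {k a c} w → T (condB k w) → (a ∷ c ∷ []) ⊆ w → a < c → c ≢ k → ⊥
condB⇒ (x ∷ w) h (.x ∷ʳ p) = condB⇒ w (proj₂ (to T-∧ h)) p
condB⇒ {k} {c = c} (x ∷ w) h (refl ∷ p) a<c c≢k =
  T-not⁻ (All.lookup (all⁺ _ w (proj₁ (to T-∧ h))) (to∈ p)) (from T-∧ (<⇒<ᵇ a<c , T-not⁺ (c≢k ∘ ≡ᵇ⇒≡ c k)))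

condB⇐ : ∀ {k} w → (∀ {a c} → (a ∷ c ∷ []) ⊆ w → a < c → c ≢ k → ⊥) → T (condB k w)
condB⇐ []          _         = tt
condB⇐ {k} (x ∷ w) noAscent = from T-∧ (all⁻ _ (All.tabulate noAscentFrom-x) , condB⇐ w (λ p → noAscent (x ∷ʳ p)))
  where
  noAscentFrom-x : ∀ {y} → y ∈ w → T (not ((x <ᵇ y) ∧ not (y ≡ᵇ k)))
  noAscentFrom-x {y} y∈w = T-not⁺ λ h →
    noAscent (refl ∷ from∈ y∈w) (<ᵇ⇒< x y (proj₁ (to T-∧ h))) (T-not⁻ (proj₂ (to T-∧ h)) ∘ ≡⇒≡ᵇ y k)

avoidsBoth : List ℕ → Bool
avoidsBoth σ = avoids σ pat120 ∧ avoids σ pat201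

counts𝔞 : ℕ → List ℕ → Bool
counts𝔞 m σ = avoids σ pat120 ∧ avoids σ pat201 ∧ (maxL σ ≡ᵇ m)

counts𝔟 : ℕ → List ℕ → Bool
counts𝔟 k ω = avoids ω pat120 ∧ condB k ω

counts𝔞⇒maxL≡ : ∀ {m} σ → T (counts𝔞 m σ) → maxL σ ≡ m
counts𝔞⇒maxL≡ {m} σ h = ≡ᵇ⇒≡ (maxL σ) m (proj₂ (to (T-∧ {avoids σ pat201}) (proj₂ (to (T-∧ {avoids σ pat120}) h))))

counts𝔞⇒≤ : ∀ {m} σ → T (counts𝔞 m σ) → All (_≤ m) σ
counts𝔞⇒≤ σ h = subst (λ M → All (_≤ M) σ) (counts𝔞⇒maxL≡ σ h) (maxL-upper σ)

lacks⇒¬counts𝔞 : ∀ {m} s → 0 < m → T (lacks m s) → ¬ T (counts𝔞 m s)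
lacks⇒¬counts𝔞 s 0<m h c with counts𝔞⇒maxL≡ s c
... | refl = lacks⇒∉ s h (maxL-∈ s 0<m)

lacks⇒maxL< : ∀ {m} s t → 0 < m → T (lacks m s) → T (counts𝔞 m (s ++ m ∷ t)) → maxL s < m
lacks⇒maxL< {m} s t 0<m h c = ≤∧≢⇒< (maxL-least s (All.++⁻ˡ s (counts𝔞⇒≤ (s ++ m ∷ t) c))) maxL≢m
  where
  maxL≢m : maxL s ≢ m
  maxL≢m refl = lacks⇒∉ s h (maxL-∈ s 0<m)

-- In s ++ m ∷ u, an entry of u below maxL s would end a 120 started by maxL s and m.
avoids120⇒maxL≤ : ∀ {m} s u → maxL s < m → T (avoids (s ++ m ∷ u) pat120) → All (maxL s ≤_) u
avoids120⇒maxL≤ {m} s u maxL<m h = All.tabulate λ {c} c∈u → ≮⇒≥ λ c<maxL →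
  P120.avoids⇒¬Occurs h (maxL s , m , c , ++⁺ (from∈ (maxL-∈ s (≤-<-trans z≤n c<maxL))) (refl ∷ from∈ c∈u) , c<maxL , maxL<m)

module Decomposition (s : List ℕ) (m : ℕ) (w : List ℕ) (maxL-s<m : maxL s < m) (w≤k : All (_≤ m ∸ maxL s) w) where

  v k : ℕ
  v = maxL s
  k = m ∸ v

  t σ : List ℕ
  t = map (v +_) w
  σ = s ++ m ∷ t

  v+k≡m : v + k ≡ m
  v+k≡m = m+[n∸m]≡n (<⇒≤ maxL-s<m)

  s<m : All (_< m) s
  s<m = All.map (λ x≤v → ≤-<-trans x≤v maxL-s<m) (maxL-upper s)

  v≤t : All (v ≤_) t
  v≤t = All.map⁺ (universal (m≤m+n v) w)

  t≤m : All (_≤ m) t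
  t≤m = All.map⁺ (All.map (λ x≤k → subst (v + _ ≤_) v+k≡m (+-monoʳ-≤ v x≤k)) w≤k)

  s≤m∷t : All (λ x → All (x ≤_) (m ∷ t)) s
  s≤m∷t = All.map (λ x≤v → <⇒≤ (≤-<-trans x≤v maxL-s<m) ∷ All.map (≤-trans x≤v) v≤t) (maxL-upper s)

  maxL-σ : maxL σ ≡ m
  maxL-σ = ≤-antisym (maxL-least σ (All.++⁺ (All.map <⇒≤ s<m) (≤-refl ∷ t≤m)))
                     (All.lookup (maxL-upper σ) (∈-++⁺ʳ s (here refl)))

  shift120 : ∀ {a b c} → Is120 a b c → Is120 (v + a) (v + b) (v + c)
  shift120 (c<a , a<b) = +-monoʳ-< v c<a , +-monoʳ-< v a<b

  unshift120 : ∀ {a b c} → Is120 (v + a) (v + b) (v + c) → Is120 a b c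
  unshift120 (c<a , a<b) = +-cancelˡ-< v _ _ c<a , +-cancelˡ-< v _ _ a<b

  sound : T (counts𝔞 m σ) → T (avoidsBoth s ∧ counts𝔟 k w)
  sound h = from T-∧ (from T-∧ (s-avoids120 , s-avoids201) , from T-∧ (w-avoids120 , w-condB))
    where
    σ-avoids120 : T (avoids σ pat120)
    σ-avoids120 = proj₁ (to (T-∧ {avoids σ pat120}) h)
    σ-avoids201 : T (avoids σ pat201)
    σ-avoids201 = proj₁ (to (T-∧ {avoids σ pat201}) (proj₂ (to (T-∧ {avoids σ pat120}) h)))
    s⊆σ : s ⊆ σ
    s⊆σ = ++⁺ʳ (m ∷ t) ⊆-refl
    s-avoids120 : T (avoids s pat120)
    s-avoids120 = P120.¬Occurs⇒avoids (P120.avoids⇒¬Occurs σ-avoids120 ∘ Occurs-⊆ s⊆σ)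
    s-avoids201 : T (avoids s pat201)
    s-avoids201 = P201.¬Occurs⇒avoids (P201.avoids⇒¬Occurs σ-avoids201 ∘ Occurs-⊆ s⊆σ)
    w-avoids120 : T (avoids w pat120)
    w-avoids120 = P120.¬Occurs⇒avoids
      (P120.avoids⇒¬Occurs σ-avoids120 ∘ Occurs-⊆ (++⁺ˡ s (m ∷ʳ ⊆-refl)) ∘ Occurs-map⁺ (v +_) shift120)
    w-condB : T (condB k w)
    w-condB = condB⇐ w λ {a} {c} p a<c c≢k → P201.avoids⇒¬Occurs σ-avoids201
      (m , v + a , v + c , ++⁺ˡ s (refl ∷ map⁺ (v +_) p) , +-monoʳ-< v a<c ,
       subst (v + c <_) v+k≡m (+-monoʳ-< v (≤∧≢⇒< (All.lookup w≤k (Any-resp-⊆ p (there (here refl)))) c≢k)))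

  complete : T (avoidsBoth s ∧ counts𝔟 k w) → T (counts𝔞 m σ)
  complete h = from T-∧ (P120.¬Occurs⇒avoids no120 , from T-∧ (P201.¬Occurs⇒avoids no201 , ≡⇒≡ᵇ (maxL σ) m maxL-σ))
    where
    s-avoids : T (avoids s pat120) × T (avoids s pat201)
    s-avoids = to (T-∧ {avoids s pat120}) (proj₁ (to (T-∧ {avoidsBoth s}) h))
    w-good : T (avoids w pat120) × T (condB k w)
    w-good = to (T-∧ {avoids w pat120}) (proj₂ (to (T-∧ {avoidsBoth s}) h))

    no120 : ¬ Occurs Is120 σ
    no120 occ with Occurs-++ proj₁ s s≤m∷t occ
    ... | inj₁ occ-s = P120.avoids⇒¬Occurs (proj₁ s-avoids) occ-s
    ... | inj₂ (_ , b , _ , refl ∷ p , _ , m<b) = <⇒≱ m<b (All.lookup t≤m (Any-resp-⊆ p (here refl)))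
    ... | inj₂ (a , b , c , _ ∷ʳ p , Rabc) =
      P120.avoids⇒¬Occurs (proj₁ w-good) (Occurs-map⁻ (v +_) unshift120 w (a , b , c , p , Rabc))

    ascent-in-t : ∀ {b c} → (b ∷ c ∷ []) ⊆ t → b < c → c < m → ⊥
    ascent-in-t p b<c c<m with ⊆-map⁻ (v +_) w p
    ... | b' ∷ c' ∷ [] , q , refl =
      condB⇒ w (proj₂ w-good) q (+-cancelˡ-< v b' c' b<c) (λ c'≡k → <-irrefl (trans (cong (v +_) c'≡k) v+k≡m) c<m)
    ... | []            , _ , ()
    ... | _ ∷ []        , _ , ()
    ... | _ ∷ _ ∷ _ ∷ _ , _ , ()

    no201 : ¬ Occurs Is201 σ
    no201 occ with Occurs-++ proj₂ s s≤m∷t occ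
    ... | inj₁ occ-s = P201.avoids⇒¬Occurs (proj₂ s-avoids) occ-s
    ... | inj₂ (_ , _ , _ , refl ∷ p , b<c , c<m) = ascent-in-t p b<c c<m
    ... | inj₂ (_ , _ , _ , _ ∷ʳ p , b<c , c<a) =
      ascent-in-t (∷ˡ⁻ p) b<c (<-≤-trans c<a (All.lookup t≤m (Any-resp-⊆ p (here refl))))

  counts𝔞-≡ : counts𝔞 m σ ≡ avoidsBoth s ∧ counts𝔟 k w
  counts𝔞-≡ = T-injective sound complete

module Continuations (m q K : ℕ) (0<m : 0 < m) (m≤q : m ≤ q) where

  afterM : List ℕ → ℕ
  afterM s = ∑ (invSuffixes (suc q) K) (λ t → 𝟙 (counts𝔞 m (s ++ m ∷ t)))

  afterM-< : ∀ s → maxL s < m → afterM s ≡ 𝟙 (avoidsBoth s) * 𝔟 K (m ∸ maxL s)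
  afterM-< s maxL<m = begin
    afterM s
      ≡⟨ ∑-invSuffixes-bounded K H (s≤s m≤q) above-m ⟩
    ∑ (words K (suc m)) H
      ≡⟨ cong (λ z → ∑ (words K z) H) (trans (+-suc v k) (cong suc v+k≡m)) ⟨
    ∑ (words K (v + suc k)) H
      ≡⟨ ∑-words-shift K v (suc k) H below-v ⟩
    ∑ (words K (suc k)) (H ∘ map (v +_))
      ≡⟨ ∑-cong-All (All.map (λ w<1+k → cong 𝟙 (Decomposition.counts𝔞-≡ s m _ maxL<m (All.map ≤-pred w<1+k)))
                             (words-bounded K (suc k))) ⟩
    ∑ (words K (suc k)) (λ w → 𝟙 (avoidsBoth s ∧ counts𝔟 k w))
      ≡⟨ ∑-𝟙-∧ (avoidsBoth s) (counts𝔟 k) (words K (suc k)) ⟩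
    𝟙 (avoidsBoth s) * 𝔟 K k ∎
    where
    v k : ℕ
    v = maxL s
    k = m ∸ v
    H : List ℕ → ℕ
    H t = 𝟙 (counts𝔞 m (s ++ m ∷ t))
    v+k≡m : v + k ≡ m
    v+k≡m = m+[n∸m]≡n (<⇒≤ maxL<m)
    above-m : ∀ t → Any (m <_) t → H t ≡ 0
    above-m t m<t = if-¬T λ c → All¬⇒¬Any (All.map ≤⇒≯ (All.++⁻ʳ s {m ∷ t} (counts𝔞⇒≤ _ c))) (there m<t)
    below-v : ∀ t → Any (_< v) t → H t ≡ 0
    below-v t t<v = if-¬T λ c →
      All¬⇒¬Any (All.map ≤⇒≯ (avoids120⇒maxL≤ s t maxL<m (proj₁ (to (T-∧ {avoids (s ++ m ∷ t) pat120}) c)))) t<v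

  afterM-≮ : ∀ s → T (lacks m s) → ¬ maxL s < m → afterM s ≡ 0
  afterM-≮ s h maxL≮m = ∑-zero (invSuffixes (suc q) K) (λ t → if-¬T (maxL≮m ∘ lacks⇒maxL< s t 0<m h))

  afterM-≡ : ∀ s → T (lacks m s) → afterM s ≡ (if maxL s <ᵇ m then 𝟙 (avoidsBoth s) * 𝔟 K (m ∸ maxL s) else 0)
  afterM-≡ s h with maxL s <? m
  ... | yes maxL<m = trans (afterM-< s maxL<m) (sym (if-T (<⇒<ᵇ maxL<m)))
  ... | no  maxL≮m = trans (afterM-≮ s h maxL≮m) (sym (if-¬T (maxL≮m ∘ <ᵇ⇒< (maxL s) m)))

firstAt-≡ : ∀ n m q → 0 < m → m ≤ q →
  FirstOccurrence.firstAt n m (𝟙 ∘ counts𝔞 m) q ≡ ∑ (upTo m) (λ j → 𝔞 q j * 𝔟 (n ∸ suc q) (m ∸ j))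
firstAt-≡ n m q 0<m m≤q = begin
  firstAt q
    ≡⟨ ∑-cong (invSeqs q) perPrefix ⟩
  ∑ (invSeqs q) (λ s → ∑ (upTo m) (λ j → 𝟙 (counts𝔞 j s) * β j))
    ≡⟨ ∑-comm (invSeqs q) (upTo m) (λ s j → 𝟙 (counts𝔞 j s) * β j) ⟩
  ∑ (upTo m) (λ j → ∑ (invSeqs q) (λ s → 𝟙 (counts𝔞 j s) * β j))
    ≡⟨ ∑-cong (upTo m) (λ j → trans (∑-*ʳ (invSeqs q) (𝟙 ∘ counts𝔞 j) (β j))
                                    (cong (_* β j) (sym (length-filterᵇ (counts𝔞 j) (invSeqs q))))) ⟩
  ∑ (upTo m) (λ j → 𝔞 q j * β j) ∎
  where
  open FirstOccurrence n m (𝟙 ∘ counts𝔞 m)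
  open Continuations m q (n ∸ suc q) 0<m m≤q

  β : ℕ → ℕ
  β j = 𝔟 (n ∸ suc q) (m ∸ j)

  byMax : ∀ s → (if maxL s <ᵇ m then 𝟙 (avoidsBoth s) * β (maxL s) else 0) ≡ ∑ (upTo m) (λ j → 𝟙 (counts𝔞 j s) * β j)
  byMax s = begin
    (if maxL s <ᵇ m then 𝟙 (avoidsBoth s) * β (maxL s) else 0)
      ≡⟨ ∑-upTo-select m (maxL s) (λ j → 𝟙 (avoidsBoth s) * β j) ⟨
    ∑ (upTo m) (λ j → if maxL s ≡ᵇ j then 𝟙 (avoidsBoth s) * β j else 0)
      ≡⟨ ∑-cong (upTo m) (λ j → sym (𝟙-∧-* (avoidsBoth s) (maxL s ≡ᵇ j) (β j))) ⟩
    ∑ (upTo m) (λ j → 𝟙 (avoidsBoth s ∧ (maxL s ≡ᵇ j)) * β j)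
      ≡⟨ ∑-cong (upTo m) (λ j → cong (λ b → 𝟙 b * β j) (∧-assoc (avoids s pat120) (avoids s pat201) (maxL s ≡ᵇ j))) ⟩
    ∑ (upTo m) (λ j → 𝟙 (counts𝔞 j s) * β j) ∎

  perPrefix : ∀ s → (if lacks m s then (if m <ᵇ suc q then completions (suc q) (s ++ [ m ]) else 0) else 0)
             ≡ ∑ (upTo m) (λ j → 𝟙 (counts𝔞 j s) * β j)
  perPrefix s with lacks m s in lacks-s
  ... | false = trans (sym (if-¬T (λ maxL<m → subst T lacks-s (maxL<⇒lacks s (<ᵇ⇒< (maxL s) m maxL<m))))) (byMax s)
  ... | true  = begin
    (if m <ᵇ suc q then completions (suc q) (s ++ [ m ]) else 0)
      ≡⟨ if-T (<⇒<ᵇ (s≤s m≤q)) ⟩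
    completions (suc q) (s ++ [ m ])
      ≡⟨ ∑-cong (invSuffixes (suc q) (n ∸ suc q)) (λ t → cong (𝟙 ∘ counts𝔞 m) (++-assoc s [ m ] t)) ⟩
    afterM s
      ≡⟨ afterM-≡ s (subst T (sym lacks-s) tt) ⟩
    (if maxL s <ᵇ m then 𝟙 (avoidsBoth s) * β (maxL s) else 0)
      ≡⟨ byMax s ⟩
    ∑ (upTo m) (λ j → 𝟙 (counts𝔞 j s) * β j) ∎

theorem13 : (n m : ℕ) → 0 < m → m < n →
    𝔞 n m ≡ Σ[ m + 1 ⋯ n ] (λ p → Σ[ 0 ⋯ m ∸ 1 ] (λ j → 𝔞 (p ∸ 1) j * 𝔟 (n ∸ p) (m ∸ j)))
-- m is matched as a successor so that Σ[ 0 ⋯ m ∸ 1 ] unfolds to a sum over upTo m.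
theorem13 n m@(suc _) 0<m m<n = begin
  𝔞 n m                                       ≡⟨ length-filterᵇ (counts𝔞 m) (invSeqs n) ⟩
  ∑ (invSeqs n) (𝟙 ∘ counts𝔞 m)               ≡⟨ firstOccurrence ⟩
  ∑ (upTo n) firstAt + ∑ (invSeqs n) (λ s → if lacks m s then 𝟙 (counts𝔞 m s) else 0)
                                              ≡⟨ cong (∑ (upTo n) firstAt +_) (∑-zero (invSeqs n) withoutM-vanishes) ⟩
  ∑ (upTo n) firstAt + 0                      ≡⟨ +-identityʳ _ ⟩
  ∑ (upTo n) firstAt                          ≡⟨ cong (λ z → ∑ (upTo z) firstAt) (m+[n∸m]≡n (<⇒≤ m<n)) ⟨
  ∑ (upTo (m + (n ∸ m))) firstAt              ≡⟨ ∑-upTo-vanishingˡ m (n ∸ m) firstAt firstAt-< ⟩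
  ∑ (upTo (n ∸ m)) (λ i → firstAt (m + i))    ≡⟨ ∑-cong (upTo (n ∸ m)) (λ i → firstAt-≡ n m (m + i) 0<m (m≤m+n m i)) ⟩
  ∑ (upTo (n ∸ m)) (λ i → F (suc m + i))      ≡⟨ Σ[suc-⋯]≡∑ m n F ⟨
  Σ[ suc m ⋯ n ] F                            ≡⟨ cong (λ a → Σ[ a ⋯ n ] F) (+-comm 1 m) ⟩
  Σ[ m + 1 ⋯ n ] F                            ∎
  where
  open FirstOccurrence n m (𝟙 ∘ counts𝔞 m)
  F : ℕ → ℕ
  F p = Σ[ 0 ⋯ m ∸ 1 ] (λ j → 𝔞 (p ∸ 1) j * 𝔟 (n ∸ p) (m ∸ j))
  withoutM-vanishes : ∀ s → (if lacks m s then 𝟙 (counts𝔞 m s) else 0) ≡ 0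
  withoutM-vanishes s = if-then-0 (lacks m s) (if-¬T ∘ lacks⇒¬counts𝔞 s 0<m)
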